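{- Let $j,k_1,k_2\ge1$ be integers and let $m,n\ge1$ be coprime integers. Then $$E_{j,k_1}(n)\,E_{j,k_2}(m)\le E_{j,k_1k_2}(nm).$$
   Context: $\mathcal{D}_n$ is the set of positive divisors of $n$. A set $U\subseteq\mathcal{D}_n^j$ is called regular if every tuple in $U$ has pairwise coprime entries. For an integer $k\ge1$, a map $g:U_g\to\mathcal{D}_n$ on a regular set $U_g\subseteq\mathcal{D}_n^j$ is $k$-regular if (0) $\gcd(g(d_1,\dots,d_j),d_i)=1$ for all $(d_1,\dots,d_j)\in U_g$ and all $i$; (1) for each $i$ and each fixed choice of the other coordinates and of $d$, the equation $g(d_1,\dots,d_{i-1},z,d_{i+1},\dots,d_j)=d$ has at most $k$ solutions $z$ with the tuple in $U_g$; (2) under the same fixing, $z\,g(d_1,\dots,d_{i-1},z,d_{i+1},\dots,d_j)=d$ has at most $k$ solutions $z$ with the tuple in $U_g$. $E_{j,k}(n)$ is the maximum of $|U_g|$ over all $k$-regular maps $g$. -}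

module Defs where

open import Data.Nat using (ℕ; zero; suc; _≤_; _*_)
open import Data.Nat.Divisibility using (_∣_)
open import Data.Nat.Coprimality using (Coprime)
open import Data.Nat.Properties using (_≟_)
open import Data.Fin using (Fin)
open import Data.Vec using (Vec; lookup; _[_]≔_)
import Data.Vec.Properties as VecP
open import Data.List using (List; []; _∷_; length)
open import Data.List.Membership.Propositional using (_∈_)
open import Data.List.Relation.Unary.Unique.Propositional using (Unique)
open import Data.Product using (_×_)
open import Relation.Nullary using (¬_; Dec; yes; no)
open import Relation.Nullary.Decidable using (_×-dec_)
open import Relation.Binary.PropositionalEquality using (_≡_)

count : {A : Set} (P : A → Set) → ((a : A) → Dec (P a)) → List A → ℕ
count P dec [] = zero
count P dec (x ∷ xs) with dec x
... | yes _ = suc (count P dec xs)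
... | no  _ = count P dec xs

-- v and u agree in every coordinate except possibly the i-th
-- (the i-th coordinate is overwritten by 0 in both before comparing)
AgreeOff : {j : ℕ} → Fin j → Vec ℕ j → Vec ℕ j → Set
AgreeOff i u v = (v [ i ]≔ 0) ≡ (u [ i ]≔ 0)

agreeOff? : {j : ℕ} (i : Fin j) (u v : Vec ℕ j) → Dec (AgreeOff i u v)
agreeOff? i u v = VecP.≡-dec _≟_ (v [ i ]≔ 0) (u [ i ]≔ 0)

-- U_g is a finite set, represented as a duplicate-free list of j-tuples;
-- g is given as a function on all j-tuples, only its values on U_g matter.
record KRegularMap (j k n : ℕ) : Set where
  field
    U        : List (Vec ℕ j)
    g        : Vec ℕ j → ℕ
    U-unique : Unique U
    U-div    : ∀ u → u ∈ U → ∀ i → lookup u i ∣ n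
    U-regular : ∀ u → u ∈ U → ∀ i i' → ¬ (i ≡ i') → Coprime (lookup u i) (lookup u i')
    g-div    : ∀ u → u ∈ U → g u ∣ n
    cond0    : ∀ u → u ∈ U → ∀ i → Coprime (g u) (lookup u i)
    cond1    : ∀ i (u : Vec ℕ j) (d : ℕ) →
               count (λ v → AgreeOff i u v × (g v ≡ d))
                     (λ v → agreeOff? i u v ×-dec (g v ≟ d)) U ≤ k
    cond2    : ∀ i (u : Vec ℕ j) (d : ℕ) →
               count (λ v → AgreeOff i u v × (lookup v i * g v ≡ d))
                     (λ v → agreeOff? i u v ×-dec (lookup v i * g v ≟ d)) U ≤ k

size : {j k n : ℕ} → KRegularMap j k n → ℕ
size G = length (KRegularMap.U G)

record IsE (j k n e : ℕ) : Set where
  field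
    attained : KRegularMap j k n
    attained-size : size attained ≡ e
    upper : (G : KRegularMap j k n) → size G ≤ e

-- For coprime n and m, coordinatewise multiplication (u , v) ↦ u · v identifies D_n^j × D_m^j
-- with D_{nm}^j, the inverse being w ↦ (gcd(n, w), gcd(m, w)) taken coordinatewise. Given a
-- k₁-regular g₁ on U₁ ⊆ D_n^j and a k₂-regular g₂ on U₂ ⊆ D_m^j, the map
-- g(w) = g₁(gcd(n, w)) · g₂(gcd(m, w)) on U₁ · U₂ is (k₁k₂)-regular: if u · v agrees with w off
-- coordinate i and has g-value (or z·g-value) d, then u and v do the same for gcd(n, w), gcd(n, d)
-- and for gcd(m, w), gcd(m, d), so every fibre of g lies in a product of a fibre of g₁ and one
-- of g₂.
module Submission where

open import Defs
open import Data.Fin using (Fin)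
open import Data.List using (List; []; _∷_; [_]; length; map; _++_; cartesianProduct)
open import Data.List.Membership.Propositional using (_∈_)
open import Data.List.Properties using (length-++; length-map; map-∘; map-id-local)
open import Data.List.Relation.Unary.All as All using (All; []; _∷_)
import Data.List.Relation.Unary.All.Properties as AllP
open import Data.List.Relation.Unary.Unique.Propositional using (Unique)
import Data.List.Relation.Unary.Unique.Propositional.Properties as Unique
open import Data.Nat using (ℕ; suc; _≤_; _*_; _+_; z≤n; s≤s; _≟_)
open import Data.Nat.Coprimality using (Coprime; coprime-divisor; coprime⇒gcd≡1)
import Data.Nat.Coprimality as Coprime
open import Data.Nat.Divisibility using (_∣_; ∣-refl; ∣-trans; ∣-antisym; m∣m*n; *-pres-∣)
open import Data.Nat.GCD using (gcd; gcd[m,n]∣m; gcd[m,n]∣n; gcd-greatest)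
open import Data.Nat.LCM using (lcm; lcm-least; gcd*lcm)
open import Data.Nat.Properties
  using (≤-trans; m≤n⇒m≤1+n; +-mono-≤; *-mono-≤; *-comm; *-identityˡ; *-distribʳ-+;
         ≤-reflexive; *-commutativeSemigroup; module ≤-Reasoning)
open import Algebra.Properties.CommutativeSemigroup *-commutativeSemigroup using (interchange)
open import Data.Product using (_×_; _,_; proj₁; proj₂; uncurry)
open import Data.Vec using (Vec; lookup; _[_]≔_; zipWith)
import Data.Vec as Vec
open import Data.Vec.Properties using ([]≔-idempotent; map-[]≔; lookup-map; lookup-zipWith)
open import Data.Vec.Relation.Binary.Pointwise.Extensional using (ext; Pointwise-≡⇒≡)
open import Function using (_∘_)
open import Relation.Nullary using (¬_; yes; no; contradiction)
open import Relation.Nullary.Decidable using (_×-dec_)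
open import Relation.Unary using (Decidable; _⟨×⟩_)
open import Relation.Unary.Properties using (_×?_)
open import Relation.Binary.PropositionalEquality
  using (_≡_; refl; sym; trans; cong; cong₂; subst; subst₂; setoid; module ≡-Reasoning)

coprime-divisors : ∀ {a b m n} → Coprime m n → a ∣ m → b ∣ n → Coprime a b
coprime-divisors m⊥n a∣m b∣n (d∣a , d∣b) = m⊥n (∣-trans d∣a a∣m , ∣-trans d∣b b∣n)

coprime-*ˡ : ∀ {a b c} → Coprime a c → Coprime b c → Coprime (a * b) c
coprime-*ˡ a⊥c b⊥c (d∣ab , d∣c) =
  b⊥c (coprime-divisor (coprime-divisors (Coprime.sym a⊥c) d∣c ∣-refl) d∣ab , d∣c)

coprime-*ʳ : ∀ {a b c} → Coprime a b → Coprime a c → Coprime a (b * c)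
coprime-*ʳ a⊥b a⊥c = Coprime.sym (coprime-*ˡ (Coprime.sym a⊥b) (Coprime.sym a⊥c))

coprime⇒*∣ : ∀ {a b n} → Coprime a b → a ∣ n → b ∣ n → a * b ∣ n
coprime⇒*∣ {a} {b} a⊥b a∣n b∣n = subst (_∣ _) lcm≡* (lcm-least a∣n b∣n)
  where
  open ≡-Reasoning
  lcm≡* : lcm a b ≡ a * b
  lcm≡* = begin
    lcm a b           ≡⟨ sym (*-identityˡ (lcm a b)) ⟩
    1 * lcm a b       ≡⟨ cong (_* lcm a b) (sym (coprime⇒gcd≡1 a⊥b)) ⟩
    gcd a b * lcm a b ≡⟨ gcd*lcm a b ⟩
    a * b             ∎

gcd[n,x*y]≡x : ∀ {n x y} → x ∣ n → Coprime n y → gcd n (x * y) ≡ x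
gcd[n,x*y]≡x {n} {x} {y} x∣n n⊥y = ∣-antisym gcd∣x (gcd-greatest x∣n (m∣m*n y))
  where
  gcd∣x : gcd n (x * y) ∣ x
  gcd∣x = coprime-divisor (coprime-divisors n⊥y (gcd[m,n]∣m n (x * y)) ∣-refl)
                          (subst (gcd n (x * y) ∣_) (*-comm x y) (gcd[m,n]∣n n (x * y)))

AgreeOff-map : ∀ {j} {i : Fin j} {u v : Vec ℕ j} (f : ℕ → ℕ) →
               AgreeOff i u v → AgreeOff i (Vec.map f u) (Vec.map f v)
AgreeOff-map {i = i} {u} {v} f v≈u = begin
  Vec.map f v [ i ]≔ 0                   ≡⟨ sym ([]≔-idempotent (Vec.map f v) i) ⟩
  (Vec.map f v [ i ]≔ f 0) [ i ]≔ 0      ≡⟨ cong (_[ i ]≔ 0) (sym (map-[]≔ f v i)) ⟩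
  Vec.map f (v [ i ]≔ 0) [ i ]≔ 0        ≡⟨ cong (λ x → Vec.map f x [ i ]≔ 0) v≈u ⟩
  Vec.map f (u [ i ]≔ 0) [ i ]≔ 0        ≡⟨ cong (_[ i ]≔ 0) (map-[]≔ f u i) ⟩
  (Vec.map f u [ i ]≔ f 0) [ i ]≔ 0      ≡⟨ []≔-idempotent (Vec.map f u) i ⟩
  Vec.map f u [ i ]≔ 0                   ∎
  where open ≡-Reasoning

module _ {A : Set} {P : A → Set} (p? : Decidable P) where

  count-++ : (L M : List A) → count P p? (L ++ M) ≡ count P p? L + count P p? M
  count-++ []      M = refl
  count-++ (x ∷ L) M with p? x
  ... | yes _ = cong suc (count-++ L M)
  ... | no  _ = count-++ L M

  count-none : (L : List A) → All (¬_ ∘ P) L → count P p? L ≡ 0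
  count-none []      []          = refl
  count-none (x ∷ L) (¬px ∷ ¬pL) with p? x
  ... | yes px = contradiction px ¬px
  ... | no  _  = count-none L ¬pL

  module _ {Q : A → Set} (q? : Decidable Q) where

    count-mono : (L : List A) → All (λ x → P x → Q x) L → count P p? L ≤ count Q q? L
    count-mono []      []             = z≤n
    count-mono (x ∷ L) (px⇒qx ∷ P⇒Q) with p? x | q? x
    ... | yes px | yes _  = s≤s (count-mono L P⇒Q)
    ... | yes px | no ¬qx = contradiction (px⇒qx px) ¬qx
    ... | no  _  | yes _  = m≤n⇒m≤1+n (count-mono L P⇒Q)
    ... | no  _  | no  _  = count-mono L P⇒Q

count-map : {A B : Set} {P : B → Set} (p? : Decidable P) (f : A → B) (L : List A) →
            count P p? (map f L) ≡ count (P ∘ f) (p? ∘ f) L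
count-map p? f []      = refl
count-map p? f (x ∷ L) with p? (f x)
... | yes _ = cong suc (count-map p? f L)
... | no  _ = count-map p? f L

module _ {A B : Set} {P : A → Set} {Q : B → Set} (p? : Decidable P) (q? : Decidable Q) where

  count-row : (a : A) (M : List B) →
              count (P ⟨×⟩ Q) (p? ×? q?) (map (a ,_) M) ≤ count P p? [ a ] * count Q q? M
  count-row a M with p? a
  ... | yes pa = begin
    count (P ⟨×⟩ Q) (p? ×? q?) (map (a ,_) M)            ≡⟨ count-map (p? ×? q?) (a ,_) M ⟩
    count (λ b → P a × Q b) (λ b → p? a ×-dec q? b) M   ≤⟨ count-mono _ q? M (All.tabulate λ _ → proj₂) ⟩
    count Q q? M                                        ≡⟨ sym (*-identityˡ _) ⟩
    1 * count Q q? M                                    ∎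
    where open ≤-Reasoning
  ... | no ¬pa =
    ≤-reflexive (count-none (p? ×? q?) (map (a ,_) M) (AllP.map⁺ (All.tabulate λ _ → ¬pa ∘ proj₁)))

  count-cartesianProduct : (L : List A) (M : List B) →
    count (P ⟨×⟩ Q) (p? ×? q?) (cartesianProduct L M) ≤ count P p? L * count Q q? M
  count-cartesianProduct []      M = z≤n
  count-cartesianProduct (a ∷ L) M = begin
    count PQ PQ? (map (a ,_) M ++ cartesianProduct L M)
      ≡⟨ count-++ PQ? (map (a ,_) M) (cartesianProduct L M) ⟩
    count PQ PQ? (map (a ,_) M) + count PQ PQ? (cartesianProduct L M)
      ≤⟨ +-mono-≤ (count-row a M) (count-cartesianProduct L M) ⟩
    count P p? [ a ] * count Q q? M + count P p? L * count Q q? M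
      ≡⟨ sym (*-distribʳ-+ (count Q q? M) (count P p? [ a ]) (count P p? L)) ⟩
    (count P p? [ a ] + count P p? L) * count Q q? M
      ≡⟨ cong (_* count Q q? M) (sym (count-++ p? [ a ] L)) ⟩
    count P p? (a ∷ L) * count Q q? M
      ∎
    where
    open ≤-Reasoning
    PQ : A × B → Set
    PQ = P ⟨×⟩ Q
    PQ? : Decidable PQ
    PQ? = p? ×? q?

count-map-cartesianProduct : {A B C : Set} {P : A → Set} {Q : B → Set} {R : C → Set}
  (p? : Decidable P) (q? : Decidable Q) (r? : Decidable R) (f : A × B → C) (L : List A) (M : List B) →
  (∀ {a b} → a ∈ L → b ∈ M → R (f (a , b)) → P a × Q b) →
  count R r? (map f (cartesianProduct L M)) ≤ count P p? L * count Q q? M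
count-map-cartesianProduct {A} {B} p? q? r? f L M R⇒P×Q = begin
  count _ r? (map f (cartesianProduct L M))        ≡⟨ count-map r? f (cartesianProduct L M) ⟩
  count _ (r? ∘ f) (cartesianProduct L M)          ≤⟨ count-mono (r? ∘ f) (p? ×? q?) (cartesianProduct L M)
                                                        (AllP.cartesianProduct⁺ (setoid A) (setoid B) L M R⇒P×Q) ⟩
  count _ (p? ×? q?) (cartesianProduct L M)        ≤⟨ count-cartesianProduct p? q? L M ⟩
  count _ p? L * count _ q? M                      ∎
  where open ≤-Reasoning

length-cartesianProduct : {A B : Set} (L : List A) (M : List B) →
                          length (cartesianProduct L M) ≡ length L * length M
length-cartesianProduct []      M = refl
length-cartesianProduct (a ∷ L) M = trans (length-++ (map (a ,_) M))
  (cong₂ _+_ (length-map (a ,_) M) (length-cartesianProduct L M))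

Unique-map-retraction : {A B : Set} {f : A → B} (r : B → A) {L : List A} →
                        All (λ x → r (f x) ≡ x) L → Unique L → Unique (map f L)
Unique-map-retraction r {L} r∘f≡id L! =
  Unique.map⁻ {f = r} (subst Unique (trans (sym (map-id-local r∘f≡id)) (map-∘ {g = r} L)) L!)

fibreSize : ∀ {j} → Fin j → Vec ℕ j → (Vec ℕ j → ℕ) → ℕ → List (Vec ℕ j) → ℕ
fibreSize i w h d = count (λ v → AgreeOff i w v × h v ≡ d) (λ v → agreeOff? i w v ×-dec (h v ≟ d))

lookup*g∣n : ∀ {j k n} (G : KRegularMap j k n) (i : Fin j) →
             ∀ u → u ∈ KRegularMap.U G → lookup u i * KRegularMap.g G u ∣ n
lookup*g∣n G i u u∈ = coprime⇒*∣ (Coprime.sym (cond0 u u∈ i)) (U-div u u∈ i) (g-div u u∈)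
  where open KRegularMap G

module Product {j k₁ k₂ n m : ℕ} (n⊥m : Coprime n m)
               (G₁ : KRegularMap j k₁ n) (G₂ : KRegularMap j k₂ m) where

  module G₁ = KRegularMap G₁
  module G₂ = KRegularMap G₂

  infixl 7 _*ᵥ_
  _*ᵥ_ : Vec ℕ j → Vec ℕ j → Vec ℕ j
  _*ᵥ_ = zipWith _*_

  part : ℕ → Vec ℕ j → Vec ℕ j
  part r = Vec.map (gcd r)

  lookup-*ᵥ : ∀ u v i → lookup (u *ᵥ v) i ≡ lookup u i * lookup v i
  lookup-*ᵥ u v i = lookup-zipWith _*_ i u v

  gcd-n : ∀ {x y} → x ∣ n → y ∣ m → gcd n (x * y) ≡ x
  gcd-n x∣n y∣m = gcd[n,x*y]≡x x∣n (coprime-divisors n⊥m ∣-refl y∣m)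

  gcd-m : ∀ {x y} → x ∣ n → y ∣ m → gcd m (x * y) ≡ y
  gcd-m {x} {y} x∣n y∣m =
    trans (cong (gcd m) (*-comm x y)) (gcd[n,x*y]≡x y∣m (coprime-divisors (Coprime.sym n⊥m) ∣-refl x∣n))

  split-* : ∀ {x y d} → x ∣ n → y ∣ m → x * y ≡ d → x ≡ gcd n d × y ≡ gcd m d
  split-* x∣n y∣m refl = sym (gcd-n x∣n y∣m) , sym (gcd-m x∣n y∣m)

  coprime-*-* : ∀ {a a′ b b′} → a ∣ n → a′ ∣ n → b ∣ m → b′ ∣ m →
                Coprime a a′ → Coprime b b′ → Coprime (a * b) (a′ * b′)
  coprime-*-* a∣n a′∣n b∣m b′∣m a⊥a′ b⊥b′ =
    coprime-*ˡ (coprime-*ʳ a⊥a′ (coprime-divisors n⊥m a∣n b′∣m))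
               (coprime-*ʳ (coprime-divisors (Coprime.sym n⊥m) b∣m a′∣n) b⊥b′)

  module _ {u v : Vec ℕ j} (u∈ : u ∈ G₁.U) (v∈ : v ∈ G₂.U) where

    part-n : part n (u *ᵥ v) ≡ u
    part-n = Pointwise-≡⇒≡ (ext λ i →
      trans (lookup-map i (gcd n) (u *ᵥ v))
            (trans (cong (gcd n) (lookup-*ᵥ u v i)) (gcd-n (G₁.U-div u u∈ i) (G₂.U-div v v∈ i))))

    part-m : part m (u *ᵥ v) ≡ v
    part-m = Pointwise-≡⇒≡ (ext λ i →
      trans (lookup-map i (gcd m) (u *ᵥ v))
            (trans (cong (gcd m) (lookup-*ᵥ u v i)) (gcd-m (G₁.U-div u u∈ i) (G₂.U-div v v∈ i))))

  U : List (Vec ℕ j)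
  U = map (uncurry _*ᵥ_) (cartesianProduct G₁.U G₂.U)

  g : Vec ℕ j → ℕ
  g w = G₁.g (part n w) * G₂.g (part m w)

  g-*ᵥ : ∀ {u v} → u ∈ G₁.U → v ∈ G₂.U → g (u *ᵥ v) ≡ G₁.g u * G₂.g v
  g-*ᵥ u∈ v∈ = cong₂ (λ a b → G₁.g a * G₂.g b) (part-n u∈ v∈) (part-m u∈ v∈)

  All-cartesianProduct : {P : Vec ℕ j × Vec ℕ j → Set} →
    (∀ {u v} → u ∈ G₁.U → v ∈ G₂.U → P (u , v)) → All P (cartesianProduct G₁.U G₂.U)
  All-cartesianProduct = AllP.cartesianProduct⁺ (setoid _) (setoid _) G₁.U G₂.U

  ∈U-elim : {P : Vec ℕ j → Set} →
    (∀ {u v} → u ∈ G₁.U → v ∈ G₂.U → P (u *ᵥ v)) → ∀ w → w ∈ U → P w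
  ∈U-elim P[u*v] w = All.lookup (AllP.map⁺ (All-cartesianProduct P[u*v]))

  U-unique : Unique U
  U-unique = Unique-map-retraction (λ w → part n w , part m w)
    (All-cartesianProduct λ u∈ v∈ → cong₂ _,_ (part-n u∈ v∈) (part-m u∈ v∈))
    (Unique.cartesianProduct⁺ G₁.U-unique G₂.U-unique)

  U-div : ∀ w → w ∈ U → ∀ i → lookup w i ∣ n * m
  U-div = ∈U-elim λ {u} {v} u∈ v∈ i →
    subst (_∣ n * m) (sym (lookup-*ᵥ u v i)) (*-pres-∣ (G₁.U-div u u∈ i) (G₂.U-div v v∈ i))

  U-regular : ∀ w → w ∈ U → ∀ i i′ → ¬ (i ≡ i′) → Coprime (lookup w i) (lookup w i′)
  U-regular = ∈U-elim λ {u} {v} u∈ v∈ i i′ i≢i′ →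
    subst₂ Coprime (sym (lookup-*ᵥ u v i)) (sym (lookup-*ᵥ u v i′))
      (coprime-*-* (G₁.U-div u u∈ i) (G₁.U-div u u∈ i′) (G₂.U-div v v∈ i) (G₂.U-div v v∈ i′)
                   (G₁.U-regular u u∈ i i′ i≢i′) (G₂.U-regular v v∈ i i′ i≢i′))

  g-div : ∀ w → w ∈ U → g w ∣ n * m
  g-div = ∈U-elim λ {u} {v} u∈ v∈ →
    subst (_∣ n * m) (sym (g-*ᵥ u∈ v∈)) (*-pres-∣ (G₁.g-div u u∈) (G₂.g-div v v∈))

  cond0 : ∀ w → w ∈ U → ∀ i → Coprime (g w) (lookup w i)
  cond0 = ∈U-elim λ {u} {v} u∈ v∈ i →
    subst₂ Coprime (sym (g-*ᵥ u∈ v∈)) (sym (lookup-*ᵥ u v i))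
      (coprime-*-* (G₁.g-div u u∈) (G₁.U-div u u∈ i) (G₂.g-div v v∈) (G₂.U-div v v∈ i)
                   (G₁.cond0 u u∈ i) (G₂.cond0 v v∈ i))

  fibreSize-≤ : ∀ {i} (h₁ h₂ h : Vec ℕ j → ℕ) →
    (∀ {u v} → u ∈ G₁.U → v ∈ G₂.U → h (u *ᵥ v) ≡ h₁ u * h₂ v) →
    (∀ u → u ∈ G₁.U → h₁ u ∣ n) → (∀ v → v ∈ G₂.U → h₂ v ∣ m) →
    (∀ w d → fibreSize i w h₁ d G₁.U ≤ k₁) → (∀ w d → fibreSize i w h₂ d G₂.U ≤ k₂) →
    ∀ w d → fibreSize i w h d U ≤ k₁ * k₂
  fibreSize-≤ {i} h₁ h₂ h h-*ᵥ h₁∣n h₂∣m bound₁ bound₂ w d =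
    ≤-trans (count-map-cartesianProduct _ _ _ (uncurry _*ᵥ_) G₁.U G₂.U split-fibre)
            (*-mono-≤ (bound₁ (part n w) (gcd n d)) (bound₂ (part m w) (gcd m d)))
    where
    split-fibre : ∀ {u v} → u ∈ G₁.U → v ∈ G₂.U → AgreeOff i w (u *ᵥ v) × h (u *ᵥ v) ≡ d →
                  (AgreeOff i (part n w) u × h₁ u ≡ gcd n d) × (AgreeOff i (part m w) v × h₂ v ≡ gcd m d)
    split-fibre {u} {v} u∈ v∈ (agree , h≡d) =
      (subst (AgreeOff i (part n w)) (part-n u∈ v∈) (AgreeOff-map (gcd n) agree) , proj₁ h-split) ,
      (subst (AgreeOff i (part m w)) (part-m u∈ v∈) (AgreeOff-map (gcd m) agree) , proj₂ h-split)
      where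
      h-split : h₁ u ≡ gcd n d × h₂ v ≡ gcd m d
      h-split = split-* (h₁∣n u u∈) (h₂∣m v v∈) (trans (sym (h-*ᵥ u∈ v∈)) h≡d)

  lookup*g-*ᵥ : ∀ i {u v} → u ∈ G₁.U → v ∈ G₂.U →
                lookup (u *ᵥ v) i * g (u *ᵥ v) ≡ (lookup u i * G₁.g u) * (lookup v i * G₂.g v)
  lookup*g-*ᵥ i {u} {v} u∈ v∈ = begin
    lookup (u *ᵥ v) i * g (u *ᵥ v)                ≡⟨ cong₂ _*_ (lookup-*ᵥ u v i) (g-*ᵥ u∈ v∈) ⟩
    (lookup u i * lookup v i) * (G₁.g u * G₂.g v) ≡⟨ interchange (lookup u i) (lookup v i) (G₁.g u) (G₂.g v) ⟩
    (lookup u i * G₁.g u) * (lookup v i * G₂.g v) ∎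
    where open ≡-Reasoning

  G : KRegularMap j (k₁ * k₂) (n * m)
  G = record
    { U         = U
    ; g         = g
    ; U-unique  = U-unique
    ; U-div     = U-div
    ; U-regular = U-regular
    ; g-div     = g-div
    ; cond0     = cond0
    ; cond1     = λ i → fibreSize-≤ G₁.g G₂.g g g-*ᵥ G₁.g-div G₂.g-div (G₁.cond1 i) (G₂.cond1 i)
    ; cond2     = λ i → fibreSize-≤ (λ u → lookup u i * G₁.g u) (λ v → lookup v i * G₂.g v)
                          (λ w → lookup w i * g w) (lookup*g-*ᵥ i) (lookup*g∣n G₁ i) (lookup*g∣n G₂ i)
                          (G₁.cond2 i) (G₂.cond2 i)
    }

  size-G : size G ≡ size G₁ * size G₂
  size-G = trans (length-map (uncurry _*ᵥ_) (cartesianProduct G₁.U G₂.U))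
                 (length-cartesianProduct G₁.U G₂.U)

lemma2 : (j k₁ k₂ m n : ℕ) → 1 ≤ j → 1 ≤ k₁ → 1 ≤ k₂ → 1 ≤ m → 1 ≤ n →
         Coprime m n →
         (e₁ e₂ e₃ : ℕ) → IsE j k₁ n e₁ → IsE j k₂ m e₂ → IsE j (k₁ * k₂) (n * m) e₃ →
         e₁ * e₂ ≤ e₃
lemma2 j k₁ k₂ m n _ _ _ _ _ m⊥n e₁ e₂ e₃ E₁ E₂ E₃ = begin
  e₁ * e₂           ≡⟨ sym (cong₂ _*_ (IsE.attained-size E₁) (IsE.attained-size E₂)) ⟩
  size G₁ * size G₂ ≡⟨ sym size-G ⟩
  size G            ≤⟨ IsE.upper E₃ G ⟩
  e₃                ∎
  where
  open ≤-Reasoning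
  G₁ : KRegularMap j k₁ n
  G₁ = IsE.attained E₁
  G₂ : KRegularMap j k₂ m
  G₂ = IsE.attained E₂
  open Product (Coprime.sym m⊥n) G₁ G₂ using (G; size-G)
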